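{- Let $n>1$ and let $\pi$ be a bipartite partial order on $[n]$. Then there is a regular resolution derivation $P_\pi$ of the clause $\overline{\pi}:=\{\overline x_{i,j}: i\prec_\pi j\}$ from the clause set $\mathrm{GT}_{\pi,n}$. Moreover, the only variables resolved on in $P_\pi$ are: the variables $x_{i,j}$ with $i,j\in M_\pi$, and the variables $x_{i,k}$ with $k\notin M_\pi$, $i\in M_\pi$ and $i\not\prec_\pi k$.
   Context: Let $[n]=\{0,\dots,n-1\}$. Variables are $x_{i,j}$ for $i\neq j$ in $[n]$, with the convention that $x_{i,j}$ and $\overline x_{j,i}$ are the same literal (so $x_{i,j}$ and $x_{j,i}$ are the same variable). For distinct $i,j,k$, $T_{i,j,k}=\overline x_{i,j}\lor\overline x_{j,k}\lor\overline x_{k,i}$. A bipartite partial order on $[n]$ is a binary relation $\pi\subseteq[n]\times[n]$ (write $i\prec_\pi j$ for $\langle i,j\rangle\in\pi$) whose domain and range are disjoint. $M_\pi$ is the set of $\pi$-minimal elements, i.e. those $i$ such that there is no $j$ with $j\prec_\pi i$. The clause set $\mathrm{GT}_{\pi,n}$ consists of: ($\alpha$) the clauses $\bigvee_{j\neq i}x_{j,i}$ for each $i\in M_\pi$; ($\beta$) the clauses $T_{i,j,k}$ for all distinct $i,j,k\in M_\pi$; ($\gamma$) the clauses $T_{i,j,k}$ for all distinct $i,j,k$ with $i,j\in M_\pi$, $i\not\prec_\pi k$ and $j\prec_\pi k$. A resolution derivation of $C$ from $F$ is a sequence of clauses ending in $C$, each in $F$ or obtained by the resolution rule (from $A'\lor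 x$ and $B'\lor\overline x$ infer $A'\lor B'$) from earlier clauses; viewed as a dag, it is regular if along every path each variable is resolved on at most once and no variable occurring in $C$ is used as a resolution variable. -}

module Defs where

open import Data.Nat using (ℕ; suc)
open import Data.Fin using (Fin; fromℕ) renaming (_<_ to _<ᶠ_)
open import Data.Bool using (Bool; T)
open import Data.List using (List; _∷_; [])
open import Data.List.Membership.Propositional using (_∈_)
open import Data.Product using (Σ; ∃; _×_; _,_; proj₁; proj₂)
open import Data.Sum using (_⊎_)
open import Data.Maybe using (Maybe; just; nothing)
open import Data.Empty using (⊥)
open import Relation.Nullary using (¬_)
open import Relation.Binary.PropositionalEquality using (_≡_; _≢_)

-- Literals: the pair (i , j) stands for the literal x_{i,j}.
-- Since x_{i,j} and the negation of x_{j,i} are the same literal,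
-- the negation of (i , j) is (j , i).

Lit : ℕ → Set
Lit n = Fin n × Fin n

neg : ∀ {n} → Lit n → Lit n
neg (i , j) = (j , i)

SameVar : ∀ {n} → Lit n → Lit n → Set
SameVar p q = p ≡ q ⊎ p ≡ neg q

Clause : ℕ → Set
Clause n = List (Lit n)

Denotes : ∀ {n} → Clause n → (Lit n → Set) → Set
Denotes C P = ∀ l → (l ∈ C → P l) × (P l → l ∈ C)

Relation : ℕ → Set
Relation n = Fin n → Fin n → Bool

_≺[_]_ : ∀ {n} → Fin n → Relation n → Fin n → Set
i ≺[ π ] j = T (π i j)

IsBipartitePO : ∀ {n} → Relation n → Set
IsBipartitePO {n} π =
  ∀ (i : Fin n) → ¬ ((∃ λ j → i ≺[ π ] j) × (∃ λ k → k ≺[ π ] i))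

Minimal : ∀ {n} → Relation n → Fin n → Set
Minimal π i = ¬ (∃ λ j → j ≺[ π ] i)

Distinct3 : ∀ {n} → Fin n → Fin n → Fin n → Set
Distinct3 i j k = i ≢ j × j ≢ k × i ≢ k

-- T_{i,j,k} = ¬x_{i,j} ∨ ¬x_{j,k} ∨ ¬x_{k,i} = x_{j,i} ∨ x_{k,j} ∨ x_{i,k}
Tcl : ∀ {n} → Fin n → Fin n → Fin n → Clause n
Tcl i j k = (j , i) ∷ (k , j) ∷ (i , k) ∷ []

GT : ∀ {n} → Relation n → Clause n → Set
GT {n} π C =
    (Σ (Fin n) λ i → Minimal π i ×
       Denotes C (λ l → ∃ λ j → j ≢ i × l ≡ (j , i)))                 -- (α)
  ⊎ (Σ (Fin n) λ i → Σ (Fin n) λ j → Σ (Fin n) λ k →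
       Distinct3 i j k × Minimal π i × Minimal π j × Minimal π k ×
       Denotes C (λ l → l ∈ Tcl i j k))                                 -- (β)
  ⊎ (Σ (Fin n) λ i → Σ (Fin n) λ j → Σ (Fin n) λ k →
       Distinct3 i j k × Minimal π i × Minimal π j ×
       ¬ (i ≺[ π ] k) × (j ≺[ π ] k) ×
       Denotes C (λ l → l ∈ Tcl i j k))                                 -- (γ)

-- the clause π̄ = { ¬x_{i,j} : i ≺ j } = { x_{j,i} : i ≺ j }
PiBar : ∀ {n} → Relation n → Lit n → Set
PiBar π (a , b) = b ≺[ π ] a

data Just {n m : ℕ} (F : Clause n → Set) (cl : Fin m → Clause n)
          (k : Fin m) : Set where
  axiom   : F (cl k) → Just F cl k
  resolve : (a b : Fin m) → a <ᶠ k → b <ᶠ k → (p : Lit n) →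
            p ∈ cl a → neg p ∈ cl b →
            Denotes (cl k) (λ l → (l ∈ cl a × l ≢ p) ⊎ (l ∈ cl b × l ≢ neg p)) →
            Just F cl k

record Derivation {n : ℕ} (F : Clause n → Set) (C : Lit n → Set) : Set where
  field
    len  : ℕ
    cl   : Fin (suc len) → Clause n
    step : (k : Fin (suc len)) → Just F cl k
    ends : Denotes (cl (fromℕ len)) C

module _ {n : ℕ} {F : Clause n → Set} {C : Lit n → Set} (P : Derivation F C) where
  open Derivation P

  pivot : Fin (suc len) → Maybe (Lit n)
  pivot k with step k
  ... | axiom _ = nothing
  ... | resolve _ _ _ _ p _ _ _ = just p

  Premise : Fin (suc len) → Fin (suc len) → Set
  Premise k k' with step k
  ... | axiom _ = ⊥
  ... | resolve a b _ _ _ _ _ _ = k' ≡ a ⊎ k' ≡ b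

  data Path : Fin (suc len) → Fin (suc len) → Set where
    edge : ∀ {k k'} → Premise k k' → Path k k'
    cons : ∀ {k k'' k'} → Premise k k'' → Path k'' k' → Path k k'

  Regular : Set
  Regular =
    (∀ k k' p q → Path k k' → pivot k ≡ just p →
       pivot k' ≡ just q → ¬ SameVar p q)
    × (∀ k p → pivot k ≡ just p →
       ¬ (∃ λ l → C l × SameVar p l))

  OnlyResolvesOn : (Lit n → Set) → Set
  OnlyResolvesOn Ok = ∀ k p → pivot k ≡ just p → Ok p

AllowedVar : ∀ {n} → Relation n → Lit n → Set
AllowedVar {n} π p = Σ (Fin n) λ i → Σ (Fin n) λ j → SameVar p (i , j) ×
  ((Minimal π i × Minimal π j) ⊎
   (Minimal π i × ¬ Minimal π j × ¬ (i ≺[ π ] j)))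

module Submission where

-- Call the π-minimal elements candidates (for being the least element).  By
-- recursion on a list S of candidates, with a map ld giving every other
-- minimal c a representative ld c ∈ S, we build a regular resolution TREE
-- (a Partial S ld) whose clause contains the literals ¬x_{u,v} of π̄ with
-- u ∈ S and the literals x_{c, ld c} of the eliminated c, and otherwise only
-- literals of π̄.
--   * S = [w]: resolve the α-clause of w with the γ-clauses T_{w, below j, j}
--     on x_{j,w}, for every non-minimal j with w ⊀ j (module Base).
--   * S = h ∷ i ∷ rest: take the trees for h ∷ rest (i merged into h) and for
--     i ∷ rest (h merged into i), resolve β-clauses T_{h,i,c} away from each
--     (module Side), and resolve the two results on x_{i,h} (merge).
-- Every pivot is an allowed variable avoiding the bounding clause and touching
-- S, which makes the tree regular.  For S = all minimal elements nothing is
-- eliminated and the clause is exactly π̄.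

open import Defs
open import Data.Nat using (ℕ; zero; suc; _+_; _<_)
import Data.Nat.Properties as ℕₚ
open import Data.Fin using (Fin; _≟_; toℕ; fromℕ; inject₁; _↑ˡ_; _↑ʳ_; splitAt)
  renaming (_<_ to _<ᶠ_)
import Data.Fin.Properties as Finₚ
open import Data.Fin.Relation.Unary.Top using (view; ‵fromℕ; ‵inject₁; view-fromℕ; view-inject₁)
open import Data.List using (List; _∷_; []; filter; _++_; map; allFin)
open import Data.List.Membership.Propositional using (_∈_; _∉_)
open import Data.List.Membership.Propositional.Properties
  using (∈-filter⁺; ∈-filter⁻; ∈-++⁺ˡ; ∈-++⁺ʳ; ∈-++⁻; ∈-map⁺; ∈-map⁻; ∈-allFin)
import Data.List.Membership.DecPropositional as DecMembership
open import Data.List.Relation.Unary.Unique.Propositional using (Unique)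
open import Data.List.Relation.Unary.Unique.Propositional.Properties using (allFin⁺; filter⁺)
open import Data.List.Relation.Unary.Any using (here; there)
import Data.List.Relation.Unary.All as All
open import Data.List.Relation.Unary.AllPairs as AllPairs using (AllPairs; []; _∷_)
open import Data.Product using (Σ; ∃; _×_; _,_; proj₁; proj₂)
open import Data.Product.Properties using (≡-dec)
open import Data.Sum using (_⊎_; inj₁; inj₂; [_,_]′)
open import Data.Maybe using (just)
open import Data.Empty using (⊥; ⊥-elim)
open import Data.Unit using (⊤; tt)
open import Relation.Nullary using (¬_; Dec; yes; no; ¬?; _×-dec_)
open import Relation.Nullary.Decidable using (T?)
open import Relation.Binary.Definitions using (DecidableEquality)
open import Relation.Binary.PropositionalEquality
  using (_≡_; _≢_; refl; sym; trans; cong; cong₂; subst; subst₂)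

module Resolution {n : ℕ} where

  _≟ₗ_ : DecidableEquality (Lit n)
  _≟ₗ_ = ≡-dec _≟_ _≟_

  SameVar-sym : ∀ {p q : Lit n} → SameVar p q → SameVar q p
  SameVar-sym (inj₁ refl) = inj₁ refl
  SameVar-sym (inj₂ refl) = inj₂ refl

  SameVar-neg : ∀ {p q : Lit n} → SameVar (neg p) q → SameVar p q
  SameVar-neg (inj₁ refl) = inj₂ refl
  SameVar-neg (inj₂ refl) = inj₁ refl

  Resolvent : Clause n → Clause n → Lit n → Lit n → Set
  Resolvent A B p l = (l ∈ A × l ≢ p) ⊎ (l ∈ B × l ≢ neg p)

  resolvent : Clause n → Clause n → Lit n → Clause n
  resolvent A B p = filter (λ l → ¬? (l ≟ₗ p)) A ++ filter (λ l → ¬? (l ≟ₗ neg p)) B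

  resolvent-denotes : ∀ A B p → Denotes (resolvent A B p) (Resolvent A B p)
  resolvent-denotes A B p l = to , from
    where
    to : l ∈ resolvent A B p → Resolvent A B p l
    to m with ∈-++⁻ (filter (λ l → ¬? (l ≟ₗ p)) A) m
    ... | inj₁ m₁ = inj₁ (∈-filter⁻ (λ l → ¬? (l ≟ₗ p)) m₁)
    ... | inj₂ m₂ = inj₂ (∈-filter⁻ (λ l → ¬? (l ≟ₗ neg p)) m₂)
    from : Resolvent A B p l → l ∈ resolvent A B p
    from (inj₁ (m , l≢p)) = ∈-++⁺ˡ (∈-filter⁺ (λ l → ¬? (l ≟ₗ p)) m l≢p)
    from (inj₂ (m , l≢¬p)) = ∈-++⁺ʳ _ (∈-filter⁺ (λ l → ¬? (l ≟ₗ neg p)) m l≢¬p)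

  resolvent-denotes′ : ∀ {C A B A′ B′} p → C ≡ resolvent A B p → A′ ≡ A → B′ ≡ B →
                       Denotes C (Resolvent A′ B′ p)
  resolvent-denotes′ p refl refl refl = resolvent-denotes _ _ p

  module Trees (F : Clause n → Set) where

    data Tree : Clause n → Set where
      leaf : ∀ {C} → F C → Tree C
      node : ∀ {A B} (p : Lit n) → Tree A → Tree B → p ∈ A → neg p ∈ B →
             Tree (resolvent A B p)

    Pivot : ∀ {C} → Tree C → Lit n → Set
    Pivot (leaf _)         q = ⊥
    Pivot (node p l r _ _) q = q ≡ p ⊎ Pivot l q ⊎ Pivot r q

    RegularTree : ∀ {C} → Tree C → Set
    RegularTree (leaf _)         = ⊤
    RegularTree (node p l r _ _) =
      RegularTree l × RegularTree r × (∀ q → Pivot l q ⊎ Pivot r q → ¬ SameVar p q)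

    module Chain {X : Set} (lit : X → Lit n) (side : X → Clause n) where

      ChainClause : Clause n → List X → Lit n → Set
      ChainClause C₀ xs l =
          (l ∈ C₀ × (∀ x → x ∈ xs → l ≢ lit x))
        ⊎ (∃ λ x → x ∈ xs × l ∈ side x × l ≢ neg (lit x))

      record ChainResult {C₀ : Clause n} (t₀ : Tree C₀) (xs : List X) : Set where
        field
          {clause} : Clause n
          tree     : Tree clause
          regular  : RegularTree tree
          pivots   : ∀ q → Pivot tree q → Pivot t₀ q ⊎ (∃ λ x → x ∈ xs × q ≡ lit x)
          denotes  : Denotes clause (ChainClause C₀ xs)

      chain : ∀ {C₀} (t₀ : Tree C₀) (xs : List X) →
        (∀ x → x ∈ xs → F (side x)) →
        (∀ x → neg (lit x) ∈ side x) →
        (∀ x → x ∈ xs → lit x ∈ C₀) →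
        AllPairs (λ x y → ¬ SameVar (lit x) (lit y)) xs →
        (∀ x → x ∈ xs → ∀ q → Pivot t₀ q → ¬ SameVar (lit x) q) →
        (∀ x y → x ∈ xs → y ∈ xs → ∀ l → l ∈ side y → l ≢ neg (lit y) → l ≢ lit x) →
        RegularTree t₀ → ChainResult t₀ xs
      chain t₀ [] _ _ _ _ _ _ reg₀ = record
        { tree = t₀ ; regular = reg₀ ; pivots = λ q h → inj₁ h
        ; denotes = λ l → (λ m → inj₁ (m , λ _ ())) ,
                          λ { (inj₁ (m , _)) → m ; (inj₂ (_ , () , _)) } }
      chain {C₀} t₀ (x ∷ xs) inF neg∈ lit∈ (x-distinct ∷ distinct) fresh noReintro reg₀ = record
        { tree = node (lit x) tree (leaf (inF x (here refl))) lit∈clause (neg∈ x)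
        ; regular = regular , tt , regular-root
        ; pivots = pivots′
        ; denotes = denotes′ }
        where
        open ChainResult (chain t₀ xs (λ y m → inF y (there m)) neg∈ (λ y m → lit∈ y (there m))
                            distinct (λ y m → fresh y (there m))
                            (λ y z m₁ m₂ → noReintro y z (there m₁) (there m₂)) reg₀)

        lit∈clause : lit x ∈ clause
        lit∈clause = proj₂ (denotes (lit x))
          (inj₁ (lit∈ x (here refl) , λ y m e → All.lookup x-distinct m (inj₁ e)))

        regular-root : ∀ q → Pivot tree q ⊎ ⊥ → ¬ SameVar (lit x) q
        regular-root q (inj₁ h) with pivots q h
        ... | inj₁ h₀ = fresh x (here refl) q h₀
        ... | inj₂ (y , m , refl) = All.lookup x-distinct m

        pivots′ : ∀ q → q ≡ lit x ⊎ Pivot tree q ⊎ ⊥ →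
                  Pivot t₀ q ⊎ (∃ λ y → y ∈ x ∷ xs × q ≡ lit y)
        pivots′ q (inj₁ e) = inj₂ (x , here refl , e)
        pivots′ q (inj₂ (inj₁ h)) with pivots q h
        ... | inj₁ h₀ = inj₁ h₀
        ... | inj₂ (y , m , e) = inj₂ (y , there m , e)

        resolved : Denotes (resolvent clause (side x) (lit x)) (Resolvent clause (side x) (lit x))
        resolved = resolvent-denotes clause (side x) (lit x)

        denotes′ : Denotes (resolvent clause (side x) (lit x)) (ChainClause C₀ (x ∷ xs))
        denotes′ l = to , from
          where
          to : l ∈ resolvent clause (side x) (lit x) → ChainClause C₀ (x ∷ xs) l
          to m with proj₁ (resolved l) m
          ... | inj₂ (m′ , l≢) = inj₂ (x , here refl , m′ , l≢)
          ... | inj₁ (m′ , l≢) with proj₁ (denotes l) m′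
          ...   | inj₁ (m₀ , avoids) =
                    inj₁ (m₀ , λ { y (here refl) → l≢ ; y (there my) → avoids y my })
          ...   | inj₂ (y , my , r) = inj₂ (y , there my , r)
          from : ChainClause C₀ (x ∷ xs) l → l ∈ resolvent clause (side x) (lit x)
          from (inj₁ (m₀ , avoids)) = proj₂ (resolved l)
            (inj₁ (proj₂ (denotes l) (inj₁ (m₀ , λ y my → avoids y (there my))) , avoids x (here refl)))
          from (inj₂ (y , here refl , ml , l≢)) = proj₂ (resolved l) (inj₂ (ml , l≢))
          from (inj₂ (y , there my , ml , l≢)) = proj₂ (resolved l)
            (inj₁ (proj₂ (denotes l) (inj₂ (y , my , ml , l≢)) ,
                   noReintro x y (here refl) (there my) l ml l≢))

    Subtree : Set
    Subtree = Σ (Clause n) Tree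

    -- Numbering the nodes of a tree in post-order: positions of the left
    -- subtree, then of the right subtree, then the root (which comes last).
    size : ∀ {C} → Tree C → ℕ
    size (leaf _)         = 0
    size (node _ l r _ _) = suc (size l) + suc (size r)

    Position : ∀ {C} → Tree C → Set
    Position t = Fin (suc (size t))

    subtreeAt : ∀ {C} (t : Tree C) → Position t → Subtree
    subtreeAt (leaf f) _ = _ , leaf f
    subtreeAt (node p l r pa pb) k with view k
    ... | ‵fromℕ     = _ , node p l r pa pb
    ... | ‵inject₁ j = [ subtreeAt l , subtreeAt r ]′ (splitAt (suc (size l)) j)

    subtreeAt-root : ∀ {C} (t : Tree C) → subtreeAt t (fromℕ (size t)) ≡ (C , t)
    subtreeAt-root (leaf _) = refl
    subtreeAt-root (node p l r pa pb) rewrite view-fromℕ (size (node p l r pa pb)) = refl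

    inject₁<fromℕ : ∀ {m} (j : Fin m) → inject₁ j <ᶠ fromℕ m
    inject₁<fromℕ {m} j =
      subst₂ _<_ (sym (Finₚ.toℕ-inject₁ j)) (sym (Finₚ.toℕ-fromℕ m)) (Finₚ.toℕ<n j)

    PremisesBefore : ∀ {C} (t : Tree C) → Position t → Subtree → Set
    PremisesBefore t k (_ , leaf _) = ⊤
    PremisesBefore t k (_ , node _ l r _ _) =
      Σ (Position t) λ a → Σ (Position t) λ b →
        a <ᶠ k × b <ᶠ k × subtreeAt t a ≡ (_ , l) × subtreeAt t b ≡ (_ , r)

    PremisesBefore-transfer : ∀ {C C′} {s : Tree C} {t : Tree C′} (e : Position s → Position t) →
      (∀ {a b} → a <ᶠ b → e a <ᶠ e b) → (∀ j → subtreeAt t (e j) ≡ subtreeAt s j) →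
      ∀ k x → PremisesBefore s k x → PremisesBefore t (e k) x
    PremisesBefore-transfer e mono same k (_ , leaf _) _ = tt
    PremisesBefore-transfer e mono same k (_ , node _ _ _ _ _) (a , b , a<k , b<k , sa , sb) =
      e a , e b , mono a<k , mono b<k , trans (same a) sa , trans (same b) sb

    module NodePositions {A B} (p : Lit n) (l : Tree A) (r : Tree B) (pa : p ∈ A) (pb : neg p ∈ B) where

      leftPos : Position l → Position (node p l r pa pb)
      leftPos j = inject₁ (j ↑ˡ suc (size r))

      rightPos : Position r → Position (node p l r pa pb)
      rightPos j = inject₁ (suc (size l) ↑ʳ j)

      subtreeAt-left : ∀ j → subtreeAt (node p l r pa pb) (leftPos j) ≡ subtreeAt l j
      subtreeAt-left j rewrite view-inject₁ (j ↑ˡ suc (size r))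
                             | Finₚ.splitAt-↑ˡ (suc (size l)) j (suc (size r)) = refl

      subtreeAt-right : ∀ j → subtreeAt (node p l r pa pb) (rightPos j) ≡ subtreeAt r j
      subtreeAt-right j rewrite view-inject₁ (suc (size l) ↑ʳ j)
                              | Finₚ.splitAt-↑ʳ (suc (size l)) (suc (size r)) j = refl

      leftPos-mono : ∀ {a b} → a <ᶠ b → leftPos a <ᶠ leftPos b
      leftPos-mono {a} {b} = subst₂ _<_ (sym (toℕ-leftPos a)) (sym (toℕ-leftPos b))
        where
        toℕ-leftPos : ∀ j → toℕ (leftPos j) ≡ toℕ j
        toℕ-leftPos j = trans (Finₚ.toℕ-inject₁ _) (Finₚ.toℕ-↑ˡ j _)

      rightPos-mono : ∀ {a b} → a <ᶠ b → rightPos a <ᶠ rightPos b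
      rightPos-mono {a} {b} a<b =
        subst₂ _<_ (sym (toℕ-rightPos a)) (sym (toℕ-rightPos b)) (ℕₚ.+-monoʳ-< (suc (size l)) a<b)
        where
        toℕ-rightPos : ∀ j → toℕ (rightPos j) ≡ suc (size l) + toℕ j
        toℕ-rightPos j = trans (Finₚ.toℕ-inject₁ _) (Finₚ.toℕ-↑ʳ (suc (size l)) j)

      premisesBefore-node : (∀ j → PremisesBefore l j (subtreeAt l j)) →
        (∀ j → PremisesBefore r j (subtreeAt r j)) →
        ∀ k → PremisesBefore (node p l r pa pb) k (subtreeAt (node p l r pa pb) k)
      premisesBefore-node inL inR k with view k
      ... | ‵fromℕ =
        leftPos (fromℕ _) , rightPos (fromℕ _) , inject₁<fromℕ _ , inject₁<fromℕ _ ,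
        trans (subtreeAt-left _) (subtreeAt-root l) , trans (subtreeAt-right _) (subtreeAt-root r)
      ... | ‵inject₁ j with splitAt (suc (size l)) j in eq
      ...   | inj₁ j′ = subst (λ k → PremisesBefore (node p l r pa pb) k (subtreeAt l j′))
                          (cong inject₁ (Finₚ.splitAt⁻¹-↑ˡ eq))
                          (PremisesBefore-transfer leftPos leftPos-mono subtreeAt-left
                             j′ (subtreeAt l j′) (inL j′))
      ...   | inj₂ j′ = subst (λ k → PremisesBefore (node p l r pa pb) k (subtreeAt r j′))
                          (cong inject₁ (Finₚ.splitAt⁻¹-↑ʳ eq))
                          (PremisesBefore-transfer rightPos rightPos-mono subtreeAt-right
                             j′ (subtreeAt r j′) (inR j′))

    premisesBefore : ∀ {C} (t : Tree C) k → PremisesBefore t k (subtreeAt t k)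
    premisesBefore (leaf _) k = tt
    premisesBefore (node p l r pa pb) =
      NodePositions.premisesBefore-node p l r pa pb (premisesBefore l) (premisesBefore r)

    Hereditary : (Subtree → Set) → Set
    Hereditary Q = ∀ {A B} (p : Lit n) (l : Tree A) (r : Tree B) pa pb →
      Q (_ , node p l r pa pb) → Q (A , l) × Q (B , r)

    everywhere : ∀ {Q} → Hereditary Q → ∀ {C} (t : Tree C) → Q (C , t) → ∀ k → Q (subtreeAt t k)
    everywhere her (leaf _) q k = q
    everywhere her (node p l r pa pb) q k with view k
    ... | ‵fromℕ = q
    ... | ‵inject₁ j with splitAt (suc (size l)) j
    ...   | inj₁ j′ = everywhere her l (proj₁ (her p l r pa pb q)) j′
    ...   | inj₂ j′ = everywhere her r (proj₂ (her p l r pa pb q)) j′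

    module Flatten {C} (t : Tree C) (reg : RegularTree t) where

      clauseAt : Position t → Clause n
      clauseAt k = proj₁ (subtreeAt t k)

      PivotAt : Position t → Lit n → Set
      PivotAt k = Pivot (proj₂ (subtreeAt t k))

      Certified : ∀ k → Just F clauseAt k → Set
      Certified k (axiom _) = ⊤
      Certified k (resolve a b _ _ p _ _ _) =
        (∀ q → PivotAt a q ⊎ PivotAt b q → PivotAt k q × ¬ SameVar p q) × PivotAt k p

      justify : ∀ k (s : Subtree) → subtreeAt t k ≡ s → PremisesBefore t k s →
                RegularTree (proj₂ s) → Σ (Just F clauseAt k) (Certified k)
      justify k (_ , leaf f) eq _ _ = axiom (subst F (cong proj₁ (sym eq)) f) , tt
      justify k (_ , node p l r pa pb) eq (a , b , a<k , b<k , ea , eb) (_ , _ , reg-root) =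
        resolve a b a<k b<k p (subst (λ s → p ∈ proj₁ s) (sym ea) pa)
                (subst (λ s → neg p ∈ proj₁ s) (sym eb) pb)
                (resolvent-denotes′ p (cong proj₁ eq) (cong proj₁ ea) (cong proj₁ eb)) ,
        (λ { q (inj₁ h) → at-k (inj₂ (inj₁ (from ea h))) , reg-root q (inj₁ (from ea h))
           ; q (inj₂ h) → at-k (inj₂ (inj₂ (from eb h))) , reg-root q (inj₂ (from eb h)) }) ,
        at-k (inj₁ refl)
        where
        from : ∀ {i s q} → subtreeAt t i ≡ s → PivotAt i q → Pivot (proj₂ s) q
        from {q = q} e = subst (λ s → Pivot (proj₂ s) q) e
        at-k : ∀ {q} → Pivot (node p l r pa pb) q → PivotAt k q
        at-k {q} = subst (λ s → Pivot (proj₂ s) q) (sym eq)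

      certified : ∀ k → Σ (Just F clauseAt k) (Certified k)
      certified k = justify k (subtreeAt t k) refl (premisesBefore t k)
        (everywhere {Q = λ s → RegularTree (proj₂ s)}
                    (λ _ _ _ _ _ h → proj₁ h , proj₁ (proj₂ h)) t reg k)

      derivation : ∀ {Target} → Denotes C Target → Derivation F Target
      derivation d = record
        { len = size t ; cl = clauseAt ; step = λ k → proj₁ (certified k)
        ; ends = subst (λ s → Denotes (proj₁ s) _) (sym (subtreeAt-root t)) d }

      module _ {Target} (d : Denotes C Target) where
        private
          P : Derivation F Target
          P = derivation d

        pivot-at : ∀ k p → pivot P k ≡ just p → PivotAt k p
        pivot-at k p e with proj₁ (certified k) | proj₂ (certified k)
        pivot-at k p refl | resolve _ _ _ _ _ _ _ _ | (_ , at-k) = at-k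

        premise-pivots : ∀ k k′ → Premise P k k′ →
          (∀ q → PivotAt k′ q → PivotAt k q) ×
          (∀ p → pivot P k ≡ just p → ∀ q → PivotAt k′ q → ¬ SameVar p q)
        premise-pivots k k′ pr with proj₁ (certified k) | proj₂ (certified k)
        premise-pivots k k′ (inj₁ refl) | resolve _ _ _ _ _ _ _ _ | (children , _) =
          (λ q h → proj₁ (children q (inj₁ h))) , λ { p refl q h → proj₂ (children q (inj₁ h)) }
        premise-pivots k k′ (inj₂ refl) | resolve _ _ _ _ _ _ _ _ | (children , _) =
          (λ q h → proj₁ (children q (inj₂ h))) , λ { p refl q h → proj₂ (children q (inj₂ h)) }

        path-pivots : ∀ k k′ → Path P k k′ →
          Σ (Position t) λ k″ → Premise P k k″ × (∀ q → PivotAt k′ q → PivotAt k″ q)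
        path-pivots k k′ (edge pr) = k′ , pr , λ q h → h
        path-pivots k k′ (cons {k'' = k″} pr path) with path-pivots k″ k′ path
        ... | (k‴ , pr′ , sub) = k″ , pr , λ q h → proj₁ (premise-pivots k″ k‴ pr′) q (sub q h)

        regular-paths : ∀ k k′ p q → Path P k k′ → pivot P k ≡ just p → pivot P k′ ≡ just q →
                        ¬ SameVar p q
        regular-paths k k′ p q path pk pk′ with path-pivots k k′ path
        ... | (k″ , pr , sub) = proj₂ (premise-pivots k k″ pr) p pk q (sub q (pivot-at k′ q pk′))

        pivot-in-tree : ∀ k p → pivot P k ≡ just p → Pivot t p
        pivot-in-tree k p e = everywhere {Q = λ s → ∀ q → Pivot (proj₂ s) q → Pivot t q}
          (λ _ _ _ _ _ h → (λ q x → h q (inj₂ (inj₁ x))) , (λ q x → h q (inj₂ (inj₂ x))))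
          t (λ q x → x) k p (pivot-at k p e)

    fromTree : ∀ {C} {Target Ok : Lit n → Set} (t : Tree C) → RegularTree t → Denotes C Target →
      (∀ q → Pivot t q → Ok q × ¬ (∃ λ l → Target l × SameVar q l)) →
      Σ (Derivation F Target) λ P → Regular P × OnlyResolvesOn P Ok
    fromTree t reg d good =
      derivation d ,
      (regular-paths d , λ k p e → proj₂ (good p (pivot-in-tree d k p e))) ,
      λ k p e → proj₁ (good p (pivot-in-tree d k p e))
      where open Flatten t reg

module GTDerivation {n : ℕ} (π : Relation n) (bip : IsBipartitePO π) where
  open Resolution {n}
  open Trees (GT π)

  M : Fin n → Set
  M = Minimal π

  minimal? : ∀ x → Dec (M x)
  minimal? x = ¬? (Finₚ.any? (λ j → T? (π j x)))

  source-minimal : ∀ {u v} → u ≺[ π ] v → M u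
  source-minimal {u} {v} u≺v (j , j≺u) = bip u ((v , u≺v) , (j , j≺u))

  target-not-minimal : ∀ {u v} → u ≺[ π ] v → ¬ M v
  target-not-minimal {u} u≺v m = m (u , u≺v)

  below : Fin n → Fin n
  below j with Finₚ.any? (λ i → T? (π i j))
  ... | yes (i , _) = i
  ... | no _        = j

  below-≺ : ∀ j → ¬ M j → below j ≺[ π ] j
  below-≺ j ¬Mj with Finₚ.any? (λ i → T? (π i j))
  ... | yes (_ , i≺j) = i≺j
  ... | no ¬pred      = ⊥-elim (¬Mj ¬pred)

  some-minimal : Fin n → Σ (Fin n) M
  some-minimal z with minimal? z
  ... | yes Mz = z , Mz
  ... | no ¬Mz = below z , source-minimal (below-≺ z ¬Mz)

  different-sources : ∀ {x y z : Fin n} → x ≢ y → ¬ SameVar (x , z) (y , z)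
  different-sources x≢y (inj₁ refl) = x≢y refl
  different-sources x≢y (inj₂ refl) = x≢y refl

  denotes-self : (C : Clause n) → Denotes C (_∈ C)
  denotes-self C l = (λ m → m) , (λ m → m)

  record Candidates (S : List (Fin n)) (ld : Fin n → Fin n) : Set where
    field
      minimal     : ∀ x → x ∈ S → M x
      distinct    : Unique S
      represented : ∀ c → M c → c ∉ S → ld c ∈ S

  Eliminated : List (Fin n) → (Fin n → Fin n) → Lit n → Set
  Eliminated S ld l = Σ (Fin n) λ c → M c × c ∉ S × l ≡ (c , ld c)

  PiBarFrom : List (Fin n) → Lit n → Set
  PiBarFrom R l = Σ (Fin n) λ u → Σ (Fin n) λ v → u ∈ R × u ≺[ π ] v × l ≡ (v , u)

  Permitted : List (Fin n) → (Fin n → Fin n) → Lit n → Set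
  Permitted S ld l = PiBar π l ⊎ Eliminated S ld l

  Touches : List (Fin n) → Lit n → Set
  Touches S q = Σ (Fin n) λ x → x ∈ S × (proj₁ q ≡ x ⊎ proj₂ q ≡ x)

  touches-ends : ∀ {S} {q : Lit n} {a b} → Touches S q → SameVar q (a , b) → a ∈ S ⊎ b ∈ S
  touches-ends (x , x∈ , inj₁ refl) (inj₁ refl) = inj₁ x∈
  touches-ends (x , x∈ , inj₂ refl) (inj₁ refl) = inj₂ x∈
  touches-ends (x , x∈ , inj₁ refl) (inj₂ refl) = inj₂ x∈
  touches-ends (x , x∈ , inj₂ refl) (inj₂ refl) = inj₁ x∈

  GoodPivot : List (Fin n) → (Fin n → Fin n) → Lit n → Set
  GoodPivot S ld q = AllowedVar π q × (∀ l → Permitted S ld l → ¬ SameVar q l) × Touches S q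

  record Partial (S : List (Fin n)) (ld : Fin n → Fin n) : Set where
    field
      {clause} : Clause n
      tree     : Tree clause
      regular  : RegularTree tree
      pivots   : ∀ q → Pivot tree q → GoodPivot S ld q
      lower    : ∀ l → PiBarFrom S l ⊎ Eliminated S ld l → l ∈ clause
      upper    : ∀ l → l ∈ clause → Permitted S ld l

  module Base (w : Fin n) (ld : Fin n → Fin n) (cand : Candidates (w ∷ []) ld) where
    open Candidates cand

    Mw : M w
    Mw = minimal w (here refl)

    ∉[w] : ∀ {c} → c ≢ w → c ∉ w ∷ []
    ∉[w] c≢w (here e) = c≢w e

    ld≡w : ∀ c → M c → c ≢ w → ld c ≡ w
    ld≡w c Mc c≢w with represented c Mc (∉[w] c≢w)
    ... | here e = e

    αw : Clause n
    αw = map (_, w) (filter (λ j → ¬? (j ≟ w)) (allFin n))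

    αw-denotes : Denotes αw (λ l → ∃ λ j → j ≢ w × l ≡ (j , w))
    αw-denotes l = to , from
      where
      to : l ∈ αw → ∃ λ j → j ≢ w × l ≡ (j , w)
      to m with ∈-map⁻ (_, w) m
      ... | (j , mj , e) = j , proj₂ (∈-filter⁻ (λ j → ¬? (j ≟ w)) {xs = allFin n} mj) , e
      from : (∃ λ j → j ≢ w × l ≡ (j , w)) → l ∈ αw
      from (j , j≢w , refl) = ∈-map⁺ (_, w) (∈-filter⁺ (λ j → ¬? (j ≟ w)) (∈-allFin j) j≢w)

    Resolved : Fin n → Set
    Resolved j = ¬ M j × ¬ (w ≺[ π ] j)

    resolved? : ∀ j → Dec (Resolved j)
    resolved? j = ¬? (minimal? j) ×-dec ¬? (T? (π w j))

    Js : List (Fin n)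
    Js = filter resolved? (allFin n)

    Js-non-minimal : ∀ {j} → j ∈ Js → ¬ M j
    Js-non-minimal m = proj₁ (proj₂ (∈-filter⁻ resolved? {xs = allFin n} m))

    Js-not-above : ∀ {j} → j ∈ Js → ¬ (w ≺[ π ] j)
    Js-not-above m = proj₂ (proj₂ (∈-filter⁻ resolved? {xs = allFin n} m))

    triangle : Fin n → Clause n
    triangle j = Tcl w (below j) j

    open Chain (_, w) triangle

    triangle-γ : ∀ j → j ∈ Js → GT π (triangle j)
    triangle-γ j m = inj₂ (inj₂ (w , below j , j , (w≢b , b≢j , w≢j) , Mw , source-minimal b≺j ,
                                 Js-not-above m , b≺j , denotes-self (triangle j)))
      where
      b≺j : below j ≺[ π ] j
      b≺j = below-≺ j (Js-non-minimal m)
      w≢b : w ≢ below j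
      w≢b refl = Js-not-above m b≺j
      b≢j : below j ≢ j
      b≢j e = Js-non-minimal m (subst M e (source-minimal b≺j))
      w≢j : w ≢ j
      w≢j refl = Js-non-minimal m Mw

    chained : ChainResult (leaf (inj₁ (w , Mw , αw-denotes))) Js
    chained = chain (leaf (inj₁ (w , Mw , αw-denotes))) Js triangle-γ (λ _ → there (there (here refl)))
      (λ j m → proj₂ (αw-denotes _) (j , (λ { refl → Js-non-minimal m Mw }) , refl))
      (AllPairs.map different-sources (filter⁺ resolved? (allFin⁺ n)))
      (λ _ _ _ ()) reintro tt
      where
      reintro : ∀ x y → x ∈ Js → y ∈ Js → ∀ l → l ∈ triangle y → l ≢ (w , y) → l ≢ (x , w)
      reintro x y mx my _ (here refl) _ refl = Js-non-minimal mx (source-minimal (below-≺ y (Js-non-minimal my)))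
      reintro x y mx my _ (there (here refl)) _ refl = Js-not-above my (below-≺ y (Js-non-minimal my))
      reintro x y mx my _ (there (there (here refl))) l≢ _ = l≢ refl

    resolved-good : ∀ j → j ∈ Js → GoodPivot (w ∷ []) ld (j , w)
    resolved-good j mj = (w , j , inj₂ refl , inj₂ (Mw , ¬Mj , w⊀j)) , avoids , (w , here refl , inj₂ refl)
      where
      ¬Mj : ¬ M j
      ¬Mj = Js-non-minimal mj
      w⊀j : ¬ (w ≺[ π ] j)
      w⊀j = Js-not-above mj
      avoids : ∀ l → Permitted (w ∷ []) ld l → ¬ SameVar (j , w) l
      avoids _ (inj₁ w≺j) (inj₁ refl) = w⊀j w≺j
      avoids _ (inj₁ j≺w) (inj₂ refl) = ¬Mj (source-minimal j≺w)
      avoids _ (inj₂ (c , Mc , _ , refl)) (inj₁ e) = ¬Mj (subst M (sym (cong proj₁ e)) Mc)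
      avoids _ (inj₂ (c , _ , c∉ , refl)) (inj₂ e) = c∉ (here (sym (cong proj₂ e)))

    α-survivor : ∀ v → v ≢ w → (∀ j → j ∈ Js → (v , w) ≢ (j , w)) →
                 Permitted (w ∷ []) ld (v , w)
    α-survivor v v≢w survives with minimal? v | T? (π w v)
    ... | yes Mv  | _        = inj₂ (v , Mv , ∉[w] v≢w , cong (v ,_) (sym (ld≡w v Mv v≢w)))
    ... | no _    | yes w≺v  = inj₁ w≺v
    ... | no ¬Mv  | no w⊀v   = ⊥-elim (survives v (∈-filter⁺ resolved? (∈-allFin v) (¬Mv , w⊀v)) refl)

    triangle-survivor : ∀ j → j ∈ Js → ∀ l → l ∈ triangle j → l ≢ (w , j) →
                        Permitted (w ∷ []) ld l
    triangle-survivor j mj _ (here refl) _ =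
      inj₂ (below j , Mb , ∉[w] b≢w , cong (below j ,_) (sym (ld≡w (below j) Mb b≢w)))
      where
      b≺j : below j ≺[ π ] j
      b≺j = below-≺ j (Js-non-minimal mj)
      Mb : M (below j)
      Mb = source-minimal b≺j
      b≢w : below j ≢ w
      b≢w e = Js-not-above mj (subst (λ z → z ≺[ π ] j) e b≺j)
    triangle-survivor j mj _ (there (here refl)) _ = inj₁ (below-≺ j (Js-non-minimal mj))
    triangle-survivor j mj _ (there (there (here refl))) l≢ = ⊥-elim (l≢ refl)

    result : Partial (w ∷ []) ld
    result = record { tree = tree ; regular = regular ; pivots = pivots′ ; lower = lower′ ; upper = upper′ }
      where
      open ChainResult chained

      pivots′ : ∀ q → Pivot tree q → GoodPivot (w ∷ []) ld q
      pivots′ q h with pivots q h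
      ... | inj₁ ()
      ... | inj₂ (j , mj , refl) = resolved-good j mj

      lower′ : ∀ l → PiBarFrom (w ∷ []) l ⊎ Eliminated (w ∷ []) ld l → l ∈ clause
      lower′ _ (inj₁ (u , v , here refl , w≺v , refl)) = proj₂ (denotes (v , w))
        (inj₁ (proj₂ (αw-denotes _) (v , v≢w , refl) ,
               λ j mj e → Js-not-above mj (subst (λ z → w ≺[ π ] z) (cong proj₁ e) w≺v)))
        where
        v≢w : v ≢ w
        v≢w e = target-not-minimal w≺v (subst M (sym e) Mw)
      lower′ _ (inj₂ (c , Mc , c∉ , refl)) = subst (λ z → (c , z) ∈ clause) (sym (ld≡w c Mc c≢w))
        (proj₂ (denotes (c , w))
          (inj₁ (proj₂ (αw-denotes _) (c , c≢w , refl) ,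
                 λ j mj e → Js-non-minimal mj (subst M (cong proj₁ e) Mc))))
        where
        c≢w : c ≢ w
        c≢w e = c∉ (here e)

      upper′ : ∀ l → l ∈ clause → Permitted (w ∷ []) ld l
      upper′ l m with proj₁ (denotes l) m
      ... | inj₂ (j , mj , ml , l≢) = triangle-survivor j mj l ml l≢
      ... | inj₁ (mα , survives) with proj₁ (αw-denotes l) mα
      ...   | (v , v≢w , refl) = α-survivor v v≢w survives

  redirect : Fin n → Fin n → (Fin n → Fin n) → Fin n → Fin n
  redirect h i ld c with c ≟ i | ld c ≟ i
  ... | yes _ | _     = h
  ... | no _  | yes _ = h
  ... | no _  | no _  = ld c

  module _ (h i : Fin n) (ld : Fin n → Fin n) where

    redirect-self : redirect h i ld i ≡ h
    redirect-self with i ≟ i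
    ... | yes _ = refl
    ... | no i≢i = ⊥-elim (i≢i refl)

    redirect-hit : ∀ c → c ≢ i → ld c ≡ i → redirect h i ld c ≡ h
    redirect-hit c c≢i e with c ≟ i | ld c ≟ i
    ... | yes _ | _       = refl
    ... | no _  | yes _   = refl
    ... | no _  | no ld≢i = ⊥-elim (ld≢i e)

    redirect-miss : ∀ c → c ≢ i → ld c ≢ i → redirect h i ld c ≡ ld c
    redirect-miss c c≢i ld≢i with c ≟ i | ld c ≟ i
    ... | yes e | _     = ⊥-elim (c≢i e)
    ... | no _  | yes e = ⊥-elim (ld≢i e)
    ... | no _  | no _  = refl

  record Half (h i : Fin n) (rest : List (Fin n)) (ld : Fin n → Fin n) : Set where
    field
      {clause} : Clause n
      tree     : Tree clause
      regular  : RegularTree tree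
      pivots   : ∀ q → Pivot tree q → GoodPivot (h ∷ i ∷ rest) ld q × ¬ SameVar (i , h) q
      has-ih   : (i , h) ∈ clause
      lower    : ∀ l → PiBarFrom (h ∷ rest) l ⊎ Eliminated (h ∷ i ∷ rest) ld l → l ∈ clause
      upper    : ∀ l → l ∈ clause → l ≢ (i , h) → Permitted (h ∷ i ∷ rest) ld l

  module Side (h i : Fin n) (rest : List (Fin n)) (ld : Fin n → Fin n)
              (cand : Candidates (h ∷ i ∷ rest) ld) (sub : Partial (h ∷ rest) (redirect h i ld)) where
    open Candidates cand
    open DecMembership (_≟_ {n}) using (_∈?_)
    module Sub = Partial sub

    S S′ : List (Fin n)
    S  = h ∷ i ∷ rest
    S′ = h ∷ rest

    ld′ : Fin n → Fin n
    ld′ = redirect h i ld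

    Mh : M h
    Mh = minimal h (here refl)

    Mi : M i
    Mi = minimal i (there (here refl))

    h≢i : h ≢ i
    h≢i = All.lookup (AllPairs.head distinct) (here refl)

    i∉S′ : i ∉ S′
    i∉S′ (here i≡h) = h≢i (sym i≡h)
    i∉S′ (there m)  = All.lookup (AllPairs.head (AllPairs.tail distinct)) m refl

    S′⊆S : ∀ {x} → x ∈ S′ → x ∈ S
    S′⊆S (here e) = here e
    S′⊆S (there m) = there (there m)

    ∉S⇒≢i : ∀ {c} → c ∉ S → c ≢ i
    ∉S⇒≢i c∉ e = c∉ (there (here e))

    Cs? : ∀ c → Dec (M c × c ∉ S × ld c ≡ i)
    Cs? c = minimal? c ×-dec ¬? (c ∈? S) ×-dec (ld c ≟ i)

    Cs : List (Fin n)
    Cs = filter Cs? (allFin n)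

    Cs⁻ : ∀ {c} → c ∈ Cs → M c × c ∉ S × ld c ≡ i
    Cs⁻ m = proj₂ (∈-filter⁻ Cs? {xs = allFin n} m)

    Cs-minimal : ∀ {c} → c ∈ Cs → M c
    Cs-minimal m = proj₁ (Cs⁻ m)

    Cs-outside : ∀ {c} → c ∈ Cs → c ∉ S
    Cs-outside m = proj₁ (proj₂ (Cs⁻ m))

    Cs-by-i : ∀ {c} → c ∈ Cs → ld c ≡ i
    Cs-by-i m = proj₂ (proj₂ (Cs⁻ m))

    Cs⁺ : ∀ {c} → M c → c ∉ S → ld c ≡ i → c ∈ Cs
    Cs⁺ Mc c∉ e = ∈-filter⁺ Cs? (∈-allFin _) (Mc , c∉ , e)

    eliminated′ : ∀ {c} → c ∈ Cs → Eliminated S′ ld′ (c , h)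
    eliminated′ {c} m = c , Cs-minimal m , (λ c∈ → Cs-outside m (S′⊆S c∈)) ,
      cong (c ,_) (sym (redirect-hit h i ld c (∉S⇒≢i (Cs-outside m)) (Cs-by-i m)))

    triangle : Fin n → Clause n
    triangle c = Tcl h i c

    open Chain (_, h) triangle

    triangle-β : ∀ c → c ∈ Cs → GT π (triangle c)
    triangle-β c m = inj₂ (inj₁ (h , i , c , (h≢i , i≢c , h≢c) , Mh , Mi , Cs-minimal m ,
                                 denotes-self (triangle c)))
      where
      i≢c : i ≢ c
      i≢c e = Cs-outside m (there (here (sym e)))
      h≢c : h ≢ c
      h≢c e = Cs-outside m (here (sym e))

    chained : ChainResult Sub.tree Cs
    chained = chain Sub.tree Cs triangle-β (λ _ → there (there (here refl)))
      (λ c m → Sub.lower (c , h) (inj₂ (eliminated′ m)))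
      (AllPairs.map different-sources (filter⁺ Cs? (allFin⁺ n)))
      fresh reintro Sub.regular
      where
      fresh : ∀ c → c ∈ Cs → ∀ q → Pivot Sub.tree q → ¬ SameVar (c , h) q
      fresh c m q hq sv = proj₁ (proj₂ (Sub.pivots q hq)) (c , h) (inj₂ (eliminated′ m)) (SameVar-sym sv)
      reintro : ∀ x y → x ∈ Cs → y ∈ Cs → ∀ l → l ∈ triangle y → l ≢ (h , y) → l ≢ (x , h)
      reintro x y mx my _ (here refl) _ e = Cs-outside mx (there (here (sym (cong proj₁ e))))
      reintro x y mx my _ (there (here refl)) _ e = h≢i (sym (cong proj₂ e))
      reintro x y mx my _ (there (there (here refl))) l≢ _ = l≢ refl

    inherited-good : ∀ q → GoodPivot S′ ld′ q → GoodPivot S ld q × ¬ SameVar (i , h) q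
    inherited-good q (allowed , avoids′ , (x , x∈ , ends)) =
      (allowed , avoids , (x , S′⊆S x∈ , ends)) ,
      λ sv → avoids′ (i , h) (inj₂ (i , Mi , i∉S′ , cong (i ,_) (sym (redirect-self h i ld))))
                     (SameVar-sym sv)
      where
      avoids : ∀ l → Permitted S ld l → ¬ SameVar q l
      avoids l (inj₁ l∈π̄) = avoids′ l (inj₁ l∈π̄)
      avoids _ (inj₂ (c , Mc , c∉ , refl)) sv with ld c ≟ i
      ... | yes ldc≡i = [ (λ c∈S′ → c∉ (S′⊆S c∈S′)) , i∉S′ ]′
                          (touches-ends (x , x∈ , ends) (subst (λ z → SameVar q (c , z)) ldc≡i sv))
      ... | no ldc≢i = avoids′ (c , ld c)
                         (inj₂ (c , Mc , (λ c∈ → c∉ (S′⊆S c∈)) ,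
                                cong (c ,_) (sym (redirect-miss h i ld c (∉S⇒≢i c∉) ldc≢i)))) sv

    new-good : ∀ c → c ∈ Cs → GoodPivot S ld (c , h) × ¬ SameVar (i , h) (c , h)
    new-good c m = ((c , h , inj₁ refl , inj₁ (Mc , Mh)) , avoids , (h , here refl , inj₂ refl)) , ¬ih
      where
      Mc : M c
      Mc = Cs-minimal m
      c∉ : c ∉ S
      c∉ = Cs-outside m
      avoids : ∀ l → Permitted S ld l → ¬ SameVar (c , h) l
      avoids _ (inj₁ l∈π̄) (inj₁ refl) = target-not-minimal l∈π̄ Mc
      avoids _ (inj₁ l∈π̄) (inj₂ refl) = target-not-minimal l∈π̄ Mh
      avoids _ (inj₂ (c′ , _ , _ , refl)) (inj₁ e) =
        h≢i (trans (cong proj₂ e) (trans (cong ld (sym (cong proj₁ e))) (Cs-by-i m)))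
      avoids _ (inj₂ (c′ , _ , c′∉ , refl)) (inj₂ e) = c′∉ (here (sym (cong proj₂ e)))
      ¬ih : ¬ SameVar (i , h) (c , h)
      ¬ih (inj₁ e) = c∉ (there (here (sym (cong proj₁ e))))
      ¬ih (inj₂ e) = h≢i (sym (cong proj₁ e))

    ∉S′⇒∉S : ∀ {c} → c ∉ S′ → c ≢ i → c ∉ S
    ∉S′⇒∉S c∉S′ c≢i (here e) = c∉S′ (here e)
    ∉S′⇒∉S c∉S′ c≢i (there (here e)) = c≢i e
    ∉S′⇒∉S c∉S′ c≢i (there (there m)) = c∉S′ (there m)

    eliminated-survivor : ∀ c → M c → c ∉ S′ → (c , ld′ c) ≢ (i , h) →
      (∀ c′ → c′ ∈ Cs → (c , ld′ c) ≢ (c′ , h)) → Permitted S ld (c , ld′ c)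
    eliminated-survivor c Mc c∉S′ ¬ih survives = by-cases (c ≟ i) (ld c ≟ i)
      where
      by-cases : Dec (c ≡ i) → Dec (ld c ≡ i) → Permitted S ld (c , ld′ c)
      by-cases (yes c≡i) _ =
        ⊥-elim (¬ih (cong₂ _,_ c≡i (trans (cong (redirect h i ld) c≡i) (redirect-self h i ld))))
      by-cases (no c≢i) (yes ldc≡i) =
        ⊥-elim (survives c (Cs⁺ Mc (∉S′⇒∉S c∉S′ c≢i) ldc≡i)
                         (cong (c ,_) (redirect-hit h i ld c c≢i ldc≡i)))
      by-cases (no c≢i) (no ldc≢i) =
        inj₂ (c , Mc , ∉S′⇒∉S c∉S′ c≢i , cong (c ,_) (redirect-miss h i ld c c≢i ldc≢i))

    resolved-not-target : ∀ {u v c} → u ≺[ π ] v → c ∈ Cs → (v , u) ≢ (c , h)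
    resolved-not-target u≺v m e = target-not-minimal u≺v (subst M (sym (cong proj₁ e)) (Cs-minimal m))

    result : Half h i rest ld
    result = record
      { tree = tree ; regular = regular ; pivots = pivots′ ; has-ih = has-ih
      ; lower = lower′ ; upper = upper′ }
      where
      open ChainResult chained

      pivots′ : ∀ q → Pivot tree q → GoodPivot S ld q × ¬ SameVar (i , h) q
      pivots′ q hq with pivots q hq
      ... | inj₁ h₀              = inherited-good q (Sub.pivots q h₀)
      ... | inj₂ (c , m , refl) = new-good c m

      has-ih : (i , h) ∈ clause
      has-ih = proj₂ (denotes (i , h))
        (inj₁ (Sub.lower (i , h) (inj₂ (i , Mi , i∉S′ , cong (i ,_) (sym (redirect-self h i ld)))) ,
               λ c m e → Cs-outside m (there (here (sym (cong proj₁ e))))))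

      lower′ : ∀ l → PiBarFrom S′ l ⊎ Eliminated S ld l → l ∈ clause
      lower′ _ (inj₁ (u , v , u∈ , u≺v , refl)) = proj₂ (denotes (v , u))
        (inj₁ (Sub.lower (v , u) (inj₁ (u , v , u∈ , u≺v , refl)) , λ c m → resolved-not-target u≺v m))
      lower′ _ (inj₂ (c , Mc , c∉ , refl)) with ld c ≟ i
      ... | yes ldc≡i = proj₂ (denotes (c , ld c))
              (inj₂ (c , Cs⁺ Mc c∉ ldc≡i ,
                     subst (λ z → (c , z) ∈ triangle c) (sym ldc≡i) (there (here refl)) ,
                     λ e → c∉ (here (cong proj₁ e))))
      ... | no ldc≢i = proj₂ (denotes (c , ld c))
              (inj₁ (subst (λ z → (c , z) ∈ Sub.clause) (redirect-miss h i ld c (∉S⇒≢i c∉) ldc≢i)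
                       (Sub.lower (c , ld′ c) (inj₂ (c , Mc , (λ c∈ → c∉ (S′⊆S c∈)) , refl))) ,
                     λ c′ m e → ldc≢i (trans (cong ld (cong proj₁ e)) (Cs-by-i m))))

      upper′ : ∀ l → l ∈ clause → l ≢ (i , h) → Permitted S ld l
      upper′ l m l≢ih with proj₁ (denotes l) m
      ... | inj₂ (c , mc , here refl , _) = ⊥-elim (l≢ih refl)
      ... | inj₂ (c , mc , there (here refl) , _) =
              inj₂ (c , Cs-minimal mc , Cs-outside mc , cong (c ,_) (sym (Cs-by-i mc)))
      ... | inj₂ (c , mc , there (there (here refl)) , l≢) = ⊥-elim (l≢ refl)
      ... | inj₁ (m′ , survives) with Sub.upper l m′
      ...   | inj₁ l∈π̄ = inj₁ l∈π̄
      ...   | inj₂ (c , Mc , c∉S′ , refl) = eliminated-survivor c Mc c∉S′ l≢ih survives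

  Permitted-anti : ∀ {S₁ S₂ ld l} → (∀ {x} → x ∈ S₂ → x ∈ S₁) →
                   Permitted S₁ ld l → Permitted S₂ ld l
  Permitted-anti S₂⊆S₁ (inj₁ l∈π̄) = inj₁ l∈π̄
  Permitted-anti S₂⊆S₁ (inj₂ (c , Mc , c∉ , e)) = inj₂ (c , Mc , (λ c∈ → c∉ (S₂⊆S₁ c∈)) , e)

  GoodPivot-cong : ∀ {S₁ S₂ ld q} → (∀ {x} → x ∈ S₁ → x ∈ S₂) → (∀ {x} → x ∈ S₂ → x ∈ S₁) →
                   GoodPivot S₁ ld q → GoodPivot S₂ ld q
  GoodPivot-cong S₁⊆S₂ S₂⊆S₁ (allowed , avoids , (x , x∈ , ends)) =
    allowed , (λ l p → avoids l (Permitted-anti S₁⊆S₂ p)) , (x , S₁⊆S₂ x∈ , ends)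

  -- The two halves are the same construction with h and i exchanged.
  swap-∈ : ∀ {h i rest} {x : Fin n} → x ∈ h ∷ i ∷ rest → x ∈ i ∷ h ∷ rest
  swap-∈ (here e) = there (here e)
  swap-∈ (there (here e)) = here e
  swap-∈ (there (there m)) = there (there m)

  candidates-swap : ∀ {h i rest ld} → Candidates (h ∷ i ∷ rest) ld → Candidates (i ∷ h ∷ rest) ld
  candidates-swap cand = record
    { minimal = λ x m → minimal x (swap-∈ m)
    ; distinct = swap-unique distinct
    ; represented = λ c Mc c∉ → swap-∈ (represented c Mc (λ m → c∉ (swap-∈ m))) }
    where
    open Candidates cand
    swap-unique : ∀ {h i rest} → Unique (h ∷ i ∷ rest) → Unique (i ∷ h ∷ rest)
    swap-unique ((h≢i All.∷ h∉) ∷ (i∉ ∷ u)) = ((λ e → h≢i (sym e)) All.∷ i∉) ∷ (h∉ ∷ u)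

  candidates-merge : ∀ {h i rest ld} → Candidates (h ∷ i ∷ rest) ld →
                     Candidates (h ∷ rest) (redirect h i ld)
  candidates-merge {h} {i} {rest} {ld} cand = record
    { minimal = λ { x (here e) → minimal x (here e) ; x (there m) → minimal x (there (there m)) }
    ; distinct = merge-unique distinct
    ; represented = represented′ }
    where
    open Candidates cand
    merge-unique : Unique (h ∷ i ∷ rest) → Unique (h ∷ rest)
    merge-unique ((_ All.∷ h∉) ∷ (_ ∷ u)) = h∉ ∷ u
    represented′ : ∀ c → M c → c ∉ h ∷ rest → redirect h i ld c ∈ h ∷ rest
    represented′ c Mc c∉ = by-cases (c ≟ i) (ld c ≟ i)
      where
      by-cases : Dec (c ≡ i) → Dec (ld c ≡ i) → redirect h i ld c ∈ h ∷ rest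
      by-cases (yes c≡i) _ = here (trans (cong (redirect h i ld) c≡i) (redirect-self h i ld))
      by-cases (no c≢i) (yes ldc≡i) = here (redirect-hit h i ld c c≢i ldc≡i)
      by-cases (no c≢i) (no ldc≢i) = subst (_∈ h ∷ rest) (sym (redirect-miss h i ld c c≢i ldc≢i))
                                       (drop-i (represented c Mc c∉S))
        where
        c∉S : c ∉ h ∷ i ∷ rest
        c∉S (here e) = c∉ (here e)
        c∉S (there (here e)) = c≢i e
        c∉S (there (there m)) = c∉ (there m)
        drop-i : ld c ∈ h ∷ i ∷ rest → ld c ∈ h ∷ rest
        drop-i (here e) = here e
        drop-i (there (here e)) = ⊥-elim (ldc≢i e)
        drop-i (there (there m)) = there m

  merge : ∀ h i rest ld → Candidates (h ∷ i ∷ rest) ld → Half h i rest ld → Half i h rest ld →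
          Partial (h ∷ i ∷ rest) ld
  merge h i rest ld cand L R = record
    { tree = node (i , h) L.tree R.tree L.has-ih R.has-ih
    ; regular = L.regular , R.regular , root-regular
    ; pivots = pivots′ ; lower = lower′ ; upper = upper′ }
    where
    module L = Half L
    module R = Half R
    open Candidates cand
    S : List (Fin n)
    S = h ∷ i ∷ rest
    Mh : M h
    Mh = minimal h (here refl)
    Mi : M i
    Mi = minimal i (there (here refl))

    root-regular : ∀ q → Pivot L.tree q ⊎ Pivot R.tree q → ¬ SameVar (i , h) q
    root-regular q (inj₁ q∈L) = proj₂ (L.pivots q q∈L)
    root-regular q (inj₂ q∈R) sv = proj₂ (R.pivots q q∈R) (SameVar-neg sv)

    root-good : GoodPivot S ld (i , h)
    root-good = (i , h , inj₁ refl , inj₁ (Mi , Mh)) , avoids , (i , there (here refl) , inj₁ refl)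
      where
      avoids : ∀ l → Permitted S ld l → ¬ SameVar (i , h) l
      avoids _ (inj₁ l∈π̄) (inj₁ refl) = target-not-minimal l∈π̄ Mi
      avoids _ (inj₁ l∈π̄) (inj₂ refl) = target-not-minimal l∈π̄ Mh
      avoids _ (inj₂ (c , _ , c∉ , refl)) (inj₁ e) = c∉ (there (here (sym (cong proj₁ e))))
      avoids _ (inj₂ (c , _ , c∉ , refl)) (inj₂ e) = c∉ (here (sym (cong proj₂ e)))

    pivots′ : ∀ q → q ≡ (i , h) ⊎ Pivot L.tree q ⊎ Pivot R.tree q → GoodPivot S ld q
    pivots′ q (inj₁ refl) = root-good
    pivots′ q (inj₂ (inj₁ q∈L)) = proj₁ (L.pivots q q∈L)
    pivots′ q (inj₂ (inj₂ q∈R)) = GoodPivot-cong swap-∈ swap-∈ (proj₁ (R.pivots q q∈R))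

    from-L : ∀ {l} → l ∈ L.clause → l ≢ (i , h) → l ∈ resolvent L.clause R.clause (i , h)
    from-L m l≢ = proj₂ (resolvent-denotes L.clause R.clause (i , h) _) (inj₁ (m , l≢))

    from-R : ∀ {l} → l ∈ R.clause → l ≢ (h , i) → l ∈ resolvent L.clause R.clause (i , h)
    from-R m l≢ = proj₂ (resolvent-denotes L.clause R.clause (i , h) _) (inj₂ (m , l≢))

    π̄≢ : ∀ {u v x y} → u ≺[ π ] v → M x → (v , u) ≢ (x , y)
    π̄≢ u≺v Mx e = target-not-minimal u≺v (subst M (sym (cong proj₁ e)) Mx)

    lower′ : ∀ l → PiBarFrom S l ⊎ Eliminated S ld l → l ∈ resolvent L.clause R.clause (i , h)
    lower′ _ (inj₁ (u , v , here e , u≺v , refl)) =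
      from-L (L.lower _ (inj₁ (u , v , here e , u≺v , refl))) (π̄≢ u≺v Mi)
    lower′ _ (inj₁ (u , v , there (here e) , u≺v , refl)) =
      from-R (R.lower _ (inj₁ (u , v , here e , u≺v , refl))) (π̄≢ u≺v Mh)
    lower′ _ (inj₁ (u , v , there (there m) , u≺v , refl)) =
      from-L (L.lower _ (inj₁ (u , v , there m , u≺v , refl))) (π̄≢ u≺v Mi)
    lower′ _ (inj₂ (c , Mc , c∉ , refl)) =
      from-L (L.lower _ (inj₂ (c , Mc , c∉ , refl))) (λ e → c∉ (there (here (cong proj₁ e))))

    upper′ : ∀ l → l ∈ resolvent L.clause R.clause (i , h) → Permitted S ld l
    upper′ l m with proj₁ (resolvent-denotes L.clause R.clause (i , h) l) m
    ... | inj₁ (m′ , l≢) = L.upper l m′ l≢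
    ... | inj₂ (m′ , l≢) = Permitted-anti swap-∈ (R.upper l m′ l≢)

  build : ∀ h rest ld → Candidates (h ∷ rest) ld → Partial (h ∷ rest) ld
  build h [] ld cand = Base.result h ld cand
  build h (i ∷ rest) ld cand = merge h i rest ld cand
    (Side.result h i rest ld cand (build h rest (redirect h i ld) (candidates-merge cand)))
    (Side.result i h rest ld (candidates-swap cand)
      (build i rest (redirect i h ld) (candidates-merge (candidates-swap cand))))

  GTResult : Set
  GTResult = Σ (Derivation (GT π) (PiBar π)) λ P → Regular P × OnlyResolvesOn P (AllowedVar π)

  from-partial : ∀ S ld → (∀ x → M x → x ∈ S) → Partial S ld → GTResult
  from-partial S ld complete p = fromTree tree regular exact good
    where
    open Partial p
    exact : Denotes clause (PiBar π)
    exact (a , b) = (λ m → in-π̄ (upper _ m)) ,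
                    λ b≺a → lower _ (inj₁ (b , a , complete b (source-minimal b≺a) , b≺a , refl))
      where
      in-π̄ : Permitted S ld (a , b) → PiBar π (a , b)
      in-π̄ (inj₁ l∈π̄) = l∈π̄
      in-π̄ (inj₂ (c , Mc , c∉ , _)) = ⊥-elim (c∉ (complete c Mc))
    good : ∀ q → Pivot tree q → AllowedVar π q × ¬ (∃ λ l → PiBar π l × SameVar q l)
    good q hq = proj₁ (pivots q hq) ,
                λ { (l , l∈π̄ , sv) → proj₁ (proj₂ (pivots q hq)) l (inj₁ l∈π̄) sv }

  from-minimal-list : ∀ S → (∀ x → M x → x ∈ S) → (∀ x → x ∈ S → M x) → Unique S →
                      ∀ {w} → w ∈ S → GTResult
  from-minimal-list (h ∷ rest) complete sound distinct _ =
    from-partial (h ∷ rest) (λ x → x) complete (build h rest (λ x → x) (record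
      { minimal = sound ; distinct = distinct
      ; represented = λ c Mc c∉ → ⊥-elim (c∉ (complete c Mc)) }))

  -- Fin n is inhabited, so some minimal element exists and the candidate list is nonempty.
  gt-derivation : Fin n → GTResult
  gt-derivation z = from-minimal-list Ms (λ x Mx → ∈-filter⁺ minimal? (∈-allFin x) Mx)
    (λ x m → proj₂ (∈-filter⁻ minimal? {xs = allFin n} m)) (filter⁺ minimal? (allFin⁺ n))
    (∈-filter⁺ minimal? (∈-allFin _) (proj₂ (some-minimal z)))
    where
    Ms : List (Fin n)
    Ms = filter minimal? (allFin n)

lemma1 : (n : ℕ) → 1 < n → (π : Relation n) → IsBipartitePO π →
    Σ (Derivation (GT π) (PiBar π)) λ P →
      Regular P × OnlyResolvesOn P (AllowedVar π)
lemma1 zero    ()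
lemma1 (suc n) _ π bip = GTDerivation.gt-derivation π bip (fromℕ n)
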